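{- Let $\alpha,\theta\in\Phi^+$ and $p\in\mathbb{Z}$. Then 1) $L_\alpha^2=\mathrm{id}$ and $F(s_{\alpha,p})\in\mathrm{Isom}(\mathbb{R}^m)$; 2) for every $w\in W_a$, the $\theta$-coordinate of $L_\alpha(\iota(w))$ equals $k(w,s_\alpha(\theta))$; 3) for every $w\in W_a$, $F(s_{\alpha,p})(\iota(w))=\iota(s_{\alpha,p}w)$.
   Context: Let $V$ be a Euclidean space with inner product $(\cdot,\cdot)$ and $\Phi\subset V$ an irreducible crystallographic root system spanning $V$, short roots of norm $1$; $\Phi^+=\{\beta_1,\dots,\beta_m\}$ the positive roots, $\Phi^-=-\Phi^+$. For $\alpha\in\Phi$, $\alpha^\vee=2\alpha/(\alpha,\alpha)$, $s_{\alpha,k}(x)=x-\big(\tfrac{2(\alpha,x)}{(\alpha,\alpha)}-k\big)\alpha$ for $k\in\mathbb{Z}$, $s_\alpha=s_{\alpha,0}$; $W_a=\langle s_{\alpha,k}\rangle\subset\mathrm{Aff}(V)$. For $\alpha\in\Phi^+$, $k\in\mathbb{Z}$, $H^1_{\alpha,k}=\{x: k<(x,\alpha^\vee)<k+1\}$; alcoves are connected components of $V$ minus all hyperplanes $\{(x,\alpha^\vee)=k\}$, $A_e=\bigcap_{\alpha\in\Phi^+}H^1_{\alpha,0}$, $A_w=w(A_e)$, and $k(w,\alpha)$ are the integers with $A_w=\bigcap_{\alpha\in\Phi^+}H^1_{\alpha,k(w,\alpha)}$; $k(w,-\alpha):=-k(w,\alpha)$. $\iota(w)=(k(w,\gamma))_{\gamma\in\Phi^+}\in\mathbb{R}^m$,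 coordinates indexed by $\Phi^+$. For $\alpha\in\Phi^+$, $L_\alpha$ is the linear map of $\mathbb{R}^m$ with matrix entries $\ell_{\beta_j,\beta_i}(\alpha)=1$ if $s_\alpha(\beta_i)=\beta_j$, $-1$ if $s_\alpha(\beta_i)=-\beta_j$, and $0$ if $s_\alpha(\beta_i)\neq\pm\beta_j$. For $p\in\mathbb{Z}$, $v_{p,\alpha}\in\mathbb{R}^m$ has $\gamma$-coordinate $-p(\alpha,s_\alpha(\gamma)^\vee)$ if $s_\alpha(\gamma)\in\Phi^+$ and $-1-p(\alpha,s_\alpha(\gamma)^\vee)$ if $s_\alpha(\gamma)\in\Phi^-$. $F(s_{\alpha,p})$ is the affine map $x\mapsto L_\alpha(x)+v_{p,\alpha}$ of $\mathbb{R}^m$.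
   Formalization: The Euclidean space V is taken as ℚ^n with a rational inner product, and ℚ^m replaces ℝ^m for $L_\alpha$ and $F(s_{\alpha,p})$, so alcoves consist of rational points. -}

module Defs where

open import Data.Nat using (ℕ; zero; suc)
open import Data.Fin using (Fin; zero; suc)
open import Data.Fin.Properties using (any?)
open import Data.Bool using (Bool; true; false; if_then_else_)
open import Data.Integer using (ℤ; +_)
open import Data.Rational using (ℚ; 0ℚ; 1ℚ; _+_; _*_; -_; _-_; _<_; _≤_; _÷_; _/_; ≢-nonZero)
import Data.Rational.Properties as ℚP
open import Data.Vec using (Vec; zipWith; map; replicate; lookup)
open import Data.Vec.Properties using (≡-dec)
open import Data.List using (List; []; _∷_)
open import Data.List.Relation.Unary.All using (All)
open import Data.Product using (Σ; ∃; _×_; _,_)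
open import Data.Sum using (_⊎_)
open import Relation.Binary.PropositionalEquality using (_≡_; _≢_)
open import Relation.Nullary using (¬_; yes; no; does)
open import Function using (_∘_)

ℤtoℚ : ℤ → ℚ
ℤtoℚ z = z / 1

2ℚ : ℚ
2ℚ = + 2 / 1

-- total division (x / 0 := 0); only ever used with nonzero divisors
_÷₀_ : ℚ → ℚ → ℚ
a ÷₀ b with b Data.Rational.≟ 0ℚ
... | yes _ = 0ℚ
... | no b≢0 = _÷_ a b {{≢-nonZero b≢0}}

sumFin : ∀ {n} → (Fin n → ℚ) → ℚ
sumFin {zero} f = 0ℚ
sumFin {suc n} f = f zero + sumFin (f ∘ suc)

V : ℕ → Set
V n = Vec ℚ n

_+ᵥ_ : ∀ {n} → V n → V n → V n
_+ᵥ_ = zipWith _+_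

_-ᵥ_ : ∀ {n} → V n → V n → V n
_-ᵥ_ = zipWith _-_

_·ᵥ_ : ∀ {n} → ℚ → V n → V n
c ·ᵥ x = map (c *_) x

-ᵥ_ : ∀ {n} → V n → V n
-ᵥ x = map -_ x

0ᵥ : ∀ {n} → V n
0ᵥ = replicate _ 0ℚ

_≟ᵥ_ : ∀ {n} (x y : V n) → Relation.Nullary.Dec (x ≡ y)
_≟ᵥ_ = ≡-dec Data.Rational._≟_

inner : ∀ {n} → (Fin n → Fin n → ℚ) → V n → V n → ℚ
inner B x y = sumFin (λ i → sumFin (λ j → lookup x i * (B i j * lookup y j)))

coPair : ∀ {n} → (Fin n → Fin n → ℚ) → V n → V n → ℚ
coPair B x a = (2ℚ * inner B a x) ÷₀ inner B a a

sAff : ∀ {n} → (Fin n → Fin n → ℚ) → V n → ℤ → V n → V n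
sAff B a k x = x -ᵥ ((coPair B x a - ℤtoℚ k) ·ᵥ a)

-- A Euclidean space ℚ^n (Gram matrix B) with an irreducible
-- crystallographic (reduced) root system Φ = {ρ i}, short roots of norm 1,
-- and a positive system Φ⁺ = {β 0, …, β (m-1)}.

record RootDatum : Set where
  field
    n   : ℕ
    B   : Fin n → Fin n → ℚ
    B-sym    : ∀ i j → B i j ≡ B j i
    B-posdef : ∀ (x : V n) → x ≢ 0ᵥ → 0ℚ < inner B x x
    N   : ℕ
    ρ   : Fin N → V n
  _∈Φ : V n → Set
  v ∈Φ = ∃ λ i → ρ i ≡ v
  field
    nonzero  : ∀ i → ρ i ≢ 0ᵥ
    spanning : ∀ (v : V n) → ∃ λ (c : Fin N → ℚ) →
                 ∀ t → lookup v t ≡ sumFin (λ i → c i * lookup (ρ i) t)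
    reduced  : ∀ i (c : ℚ) → (c ·ᵥ ρ i) ∈Φ → c ≡ 1ℚ ⊎ c ≡ - 1ℚ
    refl-closed : ∀ i j → sAff B (ρ i) (+ 0) (ρ j) ∈Φ
    integral : ∀ i j → ∃ λ (z : ℤ) → coPair B (ρ j) (ρ i) ≡ ℤtoℚ z
    irreducible : ∀ (b : Fin N → Bool) →
                 (∀ i j → b i ≡ true → b j ≡ false → inner B (ρ i) (ρ j) ≡ 0ℚ) →
                 (∀ i → b i ≡ true) ⊎ (∀ i → b i ≡ false)
    short-norm-ge : ∀ i → 1ℚ ≤ inner B (ρ i) (ρ i)
    short-norm-one : ∃ λ i → inner B (ρ i) (ρ i) ≡ 1ℚ
    m   : ℕ
    β   : Fin m → V n
    β-inj : ∀ i j → β i ≡ β j → i ≡ j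
    β-root : ∀ i → β i ∈Φ
    β-cover : ∀ i → (∃ λ j → ρ i ≡ β j) ⊎ (∃ λ j → ρ i ≡ -ᵥ β j)
    β-positive : ∃ λ (f : V n) → ∀ j → 0ℚ < inner B f (β j)

module _ (R : RootDatum) where
  open RootDatum R

  ⟪_,_⟫ : V n → V n → ℚ
  ⟪ x , y ⟫ = inner B x y

  ⟨_,_∨⟩ : V n → V n → ℚ
  ⟨ x , a ∨⟩ = coPair B x a

  s : V n → ℤ → V n → V n
  s = sAff B

  s₀ : V n → V n → V n
  s₀ a = s a (+ 0)

  -- elements of W_a are finite products of generators s_{α,k} (α ∈ Φ);
  -- a word (α₁,k₁) ∷ (α₂,k₂) ∷ … denotes s_{α₁,k₁} ∘ s_{α₂,k₂} ∘ …
  Word : Set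
  Word = List (V n × ℤ)

  IsWaWord : Word → Set
  IsWaWord w = All (λ { (a , _) → a ∈Φ }) w

  act : Word → V n → V n
  act [] x = x
  act ((a , k) ∷ w) x = s a k (act w x)

  InAe : V n → Set
  InAe x = ∀ j → (0ℚ < ⟨ x , β j ∨⟩) × (⟨ x , β j ∨⟩ < 1ℚ)

  InA : Word → V n → Set
  InA w y = ∃ λ x → InAe x × act w x ≡ y

  -- κ = (k(w,β_j))_j, i.e. A_w = ⋂_j H¹_{β_j, κ j}
  IsAlcoveCoords : Word → (Fin m → ℤ) → Set
  IsAlcoveCoords w κ = ∀ (y : V n) →
    (InA w y → ∀ j → (ℤtoℚ (κ j) < ⟨ y , β j ∨⟩) × (⟨ y , β j ∨⟩ < ℤtoℚ (κ j) + 1ℚ))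
    × ((∀ j → (ℤtoℚ (κ j) < ⟨ y , β j ∨⟩) × (⟨ y , β j ∨⟩ < ℤtoℚ (κ j) + 1ℚ)) → InA w y)

  -- points of ℝ^m (rational points), coordinates indexed by Φ⁺
  Pt : Set
  Pt = Fin m → ℚ

  ιℚ : (Fin m → ℤ) → Pt
  ιℚ κ j = ℤtoℚ (κ j)

  ℓ : Fin m → Fin m → Fin m → ℚ
  ℓ a j i =
    if does (s₀ (β a) (β i) ≟ᵥ β j) then 1ℚ
    else if does (s₀ (β a) (β i) ≟ᵥ (-ᵥ β j)) then - 1ℚ
    else 0ℚ

  L : Fin m → Pt → Pt
  L a x j = sumFin (λ i → ℓ a j i * x i)

  isPos : V n → Bool
  isPos γ = does (any? (λ j → β j ≟ᵥ γ))

  vec : ℤ → Fin m → Pt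
  vec p a g =
    if isPos σ then - (ℤtoℚ p * ⟨ β a , σ ∨⟩)
    else - 1ℚ - ℤtoℚ p * ⟨ β a , σ ∨⟩
    where σ = s₀ (β a) (β g)

  F : ℤ → Fin m → Pt → Pt
  F p a x j = L a x j + vec p a j

  dist² : Pt → Pt → ℚ
  dist² x y = sumFin (λ j → (x j - y j) * (x j - y j))

  IsIsometry : (Pt → Pt) → Set
  IsIsometry f = ∀ x y → dist² (f x) (f y) ≡ dist² x y

module Submission where

-- s_α permutes Φ⁺ up to sign, so L_α is the signed permutation matrix of an involution of Φ⁺;
-- hence L_α² = id, and F(s_{α,p}) = L_α + v_{p,α} is an isometry.  For part 3 pick x₀ ∈ A_e and
-- y = w(x₀), so that k(w,γ) is the integer k with k < (y, γ^∨) < k + 1.  Since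
-- (s_{α,p} y, γ^∨) = (y, s_α(γ)^∨) + p (α, γ^∨) with (α, γ^∨) ∈ ℤ, the integer for s_{α,p} w is
-- k(w, s_α(γ)) shifted by p (α, γ^∨), which is the γ-coordinate of F(s_{α,p})(ι(w)).

open import Data.Empty using (⊥-elim)
open import Data.Fin using (Fin; zero; suc)
open import Data.Fin.Properties using (suc-injective)
open import Data.Integer as ℤ using (ℤ)
import Data.Integer.Properties as ℤP
open import Data.List using (_∷_)
open import Data.Nat using (zero; suc)
import Data.Nat.Divisibility as ℕDiv
open import Data.Product using (_×_; _,_; proj₁; proj₂)
open import Data.Rational as ℚ using (ℚ; mkℚ; 0ℚ; 1ℚ; _+_; _*_; -_; _-_; _<_; _≤_; *≤*; 1/_)
import Data.Rational.Properties as ℚP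
open import Data.Rational.Solver using (module +-*-Solver)
import Data.Rational.Unnormalised as ℚᵘ
import Data.Rational.Unnormalised.Properties as ℚᵘP
open import Function using (_∘_)
open import Relation.Binary.Definitions using (tri<; tri≈; tri>)
open import Relation.Binary.PropositionalEquality
  using (_≡_; _≢_; refl; sym; trans; cong; cong₂; subst; subst₂; ≢-sym; module ≡-Reasoning)
open import Relation.Nullary using (yes; no)

open import Defs

open +-*-Solver
open ≡-Reasoning

module Rationals where

  ÷₀-*-cancel : ∀ a {b} → b ≢ 0ℚ → (a ÷₀ b) * b ≡ a
  ÷₀-*-cancel a {b} b≢0 with b ℚ.≟ 0ℚ
  ... | yes b≡0 = ⊥-elim (b≢0 b≡0)
  ... | no b≢0′ = let instance _ = ℚ.≢-nonZero b≢0′ in begin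
    (a * 1/ b) * b   ≡⟨ ℚP.*-assoc a (1/ b) b ⟩
    a * (1/ b * b)   ≡⟨ cong (a *_) (ℚP.*-inverseˡ b) ⟩
    a * 1ℚ           ≡⟨ ℚP.*-identityʳ a ⟩
    a                ∎

  *-cancelʳ-≡ : ∀ {u v} c → c ≢ 0ℚ → u * c ≡ v * c → u ≡ v
  *-cancelʳ-≡ {u} {v} c c≢0 uc≡vc = let instance _ = ℚ.≢-nonZero c≢0 in begin
    u                ≡⟨ ℚP.*-identityʳ u ⟨
    u * 1ℚ           ≡⟨ cong (u *_) (ℚP.*-inverseʳ c) ⟨
    u * (c * 1/ c)   ≡⟨ ℚP.*-assoc u c (1/ c) ⟨
    u * c * 1/ c     ≡⟨ cong (_* 1/ c) uc≡vc ⟩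
    v * c * 1/ c     ≡⟨ ℚP.*-assoc v c (1/ c) ⟩
    v * (c * 1/ c)   ≡⟨ cong (v *_) (ℚP.*-inverseʳ c) ⟩
    v * 1ℚ           ≡⟨ ℚP.*-identityʳ v ⟩
    v                ∎

  -- ℤtoℚ z = z / 1 goes through normalisation by gcd; on the literal mkℚ z 0 the
  -- homomorphism laws reduce to identities of integers.
  private
    fromℤ : ℤ → ℚ
    fromℤ z = mkℚ z 0 (λ { (_ , d∣1) → ℕDiv.∣1⇒≡1 d∣1 })

    ℤtoℚ≡fromℤ : ∀ z → ℤtoℚ z ≡ fromℤ z
    ℤtoℚ≡fromℤ z = ℚP.↥p/↧p≡p (fromℤ z)

    fromℤ-+ : ∀ a b → fromℤ (a ℤ.+ b) ≡ fromℤ a + fromℤ b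
    fromℤ-+ a b = ℚP.toℚᵘ-injective (ℚᵘP.≃-sym
      (ℚᵘP.≃-trans (ℚP.toℚᵘ-homo-+ (fromℤ a) (fromℤ b)) (ℚᵘ.*≡* eq)))
      where
      eq : (a ℤ.* ℤ.1ℤ ℤ.+ b ℤ.* ℤ.1ℤ) ℤ.* ℤ.1ℤ ≡ (a ℤ.+ b) ℤ.* ℤ.1ℤ
      eq = cong (ℤ._* ℤ.1ℤ) (cong₂ ℤ._+_ (ℤP.*-identityʳ a) (ℤP.*-identityʳ b))

    fromℤ-* : ∀ a b → fromℤ (a ℤ.* b) ≡ fromℤ a * fromℤ b
    fromℤ-* a b = ℚP.toℚᵘ-injective (ℚᵘP.≃-sym
      (ℚᵘP.≃-trans (ℚP.toℚᵘ-homo-* (fromℤ a) (fromℤ b)) (ℚᵘ.*≡* refl)))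

    fromℤ-neg : ∀ a → fromℤ (ℤ.- a) ≡ - fromℤ a
    fromℤ-neg a = ℚP.toℚᵘ-injective (ℚᵘP.≃-sym
      (ℚᵘP.≃-trans (ℚP.toℚᵘ-homo‿- (fromℤ a)) (ℚᵘ.*≡* refl)))

    fromℤ-mono-≤ : ∀ {a b} → a ℤ.≤ b → fromℤ a ≤ fromℤ b
    fromℤ-mono-≤ {a} {b} a≤b =
      *≤* (subst₂ ℤ._≤_ (sym (ℤP.*-identityʳ a)) (sym (ℤP.*-identityʳ b)) a≤b)

  ℤtoℚ-+ : ∀ a b → ℤtoℚ (a ℤ.+ b) ≡ ℤtoℚ a + ℤtoℚ b
  ℤtoℚ-+ a b rewrite ℤtoℚ≡fromℤ (a ℤ.+ b) | ℤtoℚ≡fromℤ a | ℤtoℚ≡fromℤ b = fromℤ-+ a b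

  ℤtoℚ-* : ∀ a b → ℤtoℚ (a ℤ.* b) ≡ ℤtoℚ a * ℤtoℚ b
  ℤtoℚ-* a b rewrite ℤtoℚ≡fromℤ (a ℤ.* b) | ℤtoℚ≡fromℤ a | ℤtoℚ≡fromℤ b = fromℤ-* a b

  ℤtoℚ-neg : ∀ a → ℤtoℚ (ℤ.- a) ≡ - ℤtoℚ a
  ℤtoℚ-neg a rewrite ℤtoℚ≡fromℤ (ℤ.- a) | ℤtoℚ≡fromℤ a = fromℤ-neg a

  ℤtoℚ-mono-≤ : ∀ {a b} → a ℤ.≤ b → ℤtoℚ a ≤ ℤtoℚ b
  ℤtoℚ-mono-≤ {a} {b} a≤b rewrite ℤtoℚ≡fromℤ a | ℤtoℚ≡fromℤ b = fromℤ-mono-≤ a≤b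

  ℤtoℚ-suc : ∀ a → ℤtoℚ (ℤ.suc a) ≡ ℤtoℚ a + 1ℚ
  ℤtoℚ-suc a = trans (ℤtoℚ-+ ℤ.1ℤ a) (ℚP.+-comm 1ℚ (ℤtoℚ a))

  ℤtoℚ-neg-+-1 : ∀ a → ℤtoℚ (ℤ.- a ℤ.+ ℤ.-1ℤ) ≡ - ℤtoℚ a + - 1ℚ
  ℤtoℚ-neg-+-1 a = trans (ℤtoℚ-+ (ℤ.- a) ℤ.-1ℤ) (cong (_+ - 1ℚ) (ℤtoℚ-neg a))

  ℤtoℚ-<⇒+1≤ : ∀ {i j} → i ℤ.< j → ℤtoℚ i + 1ℚ ≤ ℤtoℚ j
  ℤtoℚ-<⇒+1≤ {i} i<j = subst (_≤ _) (ℤtoℚ-suc i) (ℤtoℚ-mono-≤ (ℤP.i<j⇒suc[i]≤j i<j))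

  InUnitInterval : ℤ → ℚ → Set
  InUnitInterval k t = (ℤtoℚ k < t) × (t < ℤtoℚ k + 1ℚ)

  InUnitInterval-unique : ∀ a b {t} → InUnitInterval a t → InUnitInterval b t → a ≡ b
  InUnitInterval-unique a b (a<t , t<a+1) (b<t , t<b+1) with ℤP.<-cmp a b
  ... | tri≈ _ a≡b _ = a≡b
  ... | tri< a<b _ _ = ⊥-elim (ℚP.<-asym t<a+1 (ℚP.≤-<-trans (ℤtoℚ-<⇒+1≤ a<b) b<t))
  ... | tri> _ _ b<a = ⊥-elim (ℚP.<-asym t<b+1 (ℚP.≤-<-trans (ℤtoℚ-<⇒+1≤ b<a) a<t))

  InUnitInterval-+ : ∀ a {t} z → InUnitInterval a t → InUnitInterval (a ℤ.+ z) (t + ℤtoℚ z)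
  InUnitInterval-+ a {t} z (a<t , t<a+1) =
      subst (_< t + ℤtoℚ z) (sym (ℤtoℚ-+ a z)) (ℚP.+-monoˡ-< (ℤtoℚ z) a<t)
    , subst (t + ℤtoℚ z <_) shuffle (ℚP.+-monoˡ-< (ℤtoℚ z) t<a+1)
    where
    shuffle : ℤtoℚ a + 1ℚ + ℤtoℚ z ≡ ℤtoℚ (a ℤ.+ z) + 1ℚ
    shuffle = trans (solve 3 (λ A O Z → A :+ O :+ Z := A :+ Z :+ O) refl (ℤtoℚ a) 1ℚ (ℤtoℚ z))
                    (cong (_+ 1ℚ) (sym (ℤtoℚ-+ a z)))

  InUnitInterval-neg : ∀ a {t} → InUnitInterval a t → InUnitInterval (ℤ.- a ℤ.+ ℤ.-1ℤ) (- t)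
  InUnitInterval-neg a {t} (a<t , t<a+1) =
      subst (_< - t) (sym lower) (ℚP.neg-antimono-< t<a+1)
    , subst (- t <_) upper (ℚP.neg-antimono-< a<t)
    where
    lower : ℤtoℚ (ℤ.- a ℤ.+ ℤ.-1ℤ) ≡ - (ℤtoℚ a + 1ℚ)
    lower = trans (ℤtoℚ-neg-+-1 a) (sym (ℚP.neg-distrib-+ (ℤtoℚ a) 1ℚ))
    upper : - ℤtoℚ a ≡ ℤtoℚ (ℤ.- a ℤ.+ ℤ.-1ℤ) + 1ℚ
    upper = trans (solve 2 (λ A O → :- A := :- (A :+ O) :+ O) refl (ℤtoℚ a) 1ℚ)
                  (cong (_+ 1ℚ) (sym lower))

module FiniteSums where

  open import Algebra.Bundles using (CommutativeRing)
  open import Algebra.Properties.Semiring.Sum (CommutativeRing.semiring ℚP.+-*-commutativeRing)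
    using (sum; sum-cong-≗; ∑-distrib-+; *-distribˡ-sum; ∑-comm; sum-permute)
  open import Data.Fin.Permutation using (Permutation; _⟨$⟩ʳ_)

  sumFin≡sum : ∀ {k} (f : Fin k → ℚ) → sumFin f ≡ sum f
  sumFin≡sum {zero} f = refl
  sumFin≡sum {suc k} f = cong (f zero +_) (sumFin≡sum (f ∘ suc))

  sumFin-cong : ∀ {k} {f g : Fin k → ℚ} → (∀ i → f i ≡ g i) → sumFin f ≡ sumFin g
  sumFin-cong {f = f} {g} f≗g = begin
    sumFin f ≡⟨ sumFin≡sum f ⟩
    sum f    ≡⟨ sum-cong-≗ f≗g ⟩
    sum g    ≡⟨ sumFin≡sum g ⟨
    sumFin g ∎

  sumFin-+ : ∀ {k} (f g : Fin k → ℚ) → sumFin (λ i → f i + g i) ≡ sumFin f + sumFin g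
  sumFin-+ f g = begin
    sumFin (λ i → f i + g i) ≡⟨ sumFin≡sum (λ i → f i + g i) ⟩
    sum (λ i → f i + g i)    ≡⟨ ∑-distrib-+ f g ⟩
    sum f + sum g            ≡⟨ cong₂ _+_ (sumFin≡sum f) (sumFin≡sum g) ⟨
    sumFin f + sumFin g      ∎

  *-distribˡ-sumFin : ∀ {k} c (f : Fin k → ℚ) → c * sumFin f ≡ sumFin (λ i → c * f i)
  *-distribˡ-sumFin c f = begin
    c * sumFin f             ≡⟨ cong (c *_) (sumFin≡sum f) ⟩
    c * sum f                ≡⟨ *-distribˡ-sum c f ⟩
    sum (λ i → c * f i)      ≡⟨ sumFin≡sum (λ i → c * f i) ⟨
    sumFin (λ i → c * f i)   ∎

  sumFin-comm : ∀ {k l} (f : Fin k → Fin l → ℚ) →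
    sumFin (λ i → sumFin (λ j → f i j)) ≡ sumFin (λ j → sumFin (λ i → f i j))
  sumFin-comm f = begin
    sumFin (λ i → sumFin (f i))           ≡⟨ sumFin-cong (λ i → sumFin≡sum (f i)) ⟩
    sumFin (λ i → sum (f i))              ≡⟨ sumFin≡sum (λ i → sum (f i)) ⟩
    sum (λ i → sum (f i))                 ≡⟨ ∑-comm f ⟩
    sum (λ j → sum (λ i → f i j))         ≡⟨ sumFin≡sum (λ j → sum (λ i → f i j)) ⟨
    sumFin (λ j → sum (λ i → f i j))      ≡⟨ sumFin-cong (λ j → sumFin≡sum (λ i → f i j)) ⟨
    sumFin (λ j → sumFin (λ i → f i j))   ∎

  sumFin-permute : ∀ {k} (f : Fin k → ℚ) (π : Permutation k k) → sumFin f ≡ sumFin (f ∘ (π ⟨$⟩ʳ_))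
  sumFin-permute f π = begin
    sumFin f                 ≡⟨ sumFin≡sum f ⟩
    sum f                    ≡⟨ sum-permute f π ⟩
    sum (f ∘ (π ⟨$⟩ʳ_))      ≡⟨ sumFin≡sum (f ∘ (π ⟨$⟩ʳ_)) ⟨
    sumFin (f ∘ (π ⟨$⟩ʳ_))   ∎

  sumFin-zero : ∀ {k} (f : Fin k → ℚ) → (∀ i → f i ≡ 0ℚ) → sumFin f ≡ 0ℚ
  sumFin-zero {zero} f f≗0 = refl
  sumFin-zero {suc k} f f≗0 = cong₂ _+_ (f≗0 zero) (sumFin-zero (f ∘ suc) (f≗0 ∘ suc))

  sumFin-single : ∀ {k} (f : Fin k → ℚ) d → (∀ i → i ≢ d → f i ≡ 0ℚ) → sumFin f ≡ f d
  sumFin-single {suc k} f zero rest≗0 =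
    trans (cong (f zero +_) (sumFin-zero (f ∘ suc) (λ i → rest≗0 (suc i) (λ ()))))
          (ℚP.+-identityʳ (f zero))
  sumFin-single {suc k} f (suc d) rest≗0 =
    trans (cong₂ _+_ (rest≗0 zero (λ ()))
                     (sumFin-single (f ∘ suc) d (λ i i≢d → rest≗0 (suc i) (i≢d ∘ suc-injective))))
          (ℚP.+-identityˡ (f (suc d)))

  sumFin-nonNeg : ∀ {k} (f : Fin k → ℚ) → (∀ i → 0ℚ ≤ f i) → 0ℚ ≤ sumFin f
  sumFin-nonNeg {zero} f f≥0 = ℚP.≤-refl
  sumFin-nonNeg {suc k} f f≥0 = ℚP.+-mono-≤ (f≥0 zero) (sumFin-nonNeg (f ∘ suc) (f≥0 ∘ suc))

  ≤-sumFin : ∀ {k} (f : Fin k → ℚ) → (∀ i → 0ℚ ≤ f i) → ∀ j → f j ≤ sumFin f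
  ≤-sumFin {suc k} f f≥0 zero = subst (_≤ sumFin f) (ℚP.+-identityʳ (f zero))
    (ℚP.+-monoʳ-≤ (f zero) (sumFin-nonNeg (f ∘ suc) (f≥0 ∘ suc)))
  ≤-sumFin {suc k} f f≥0 (suc j) = ℚP.≤-trans (≤-sumFin (f ∘ suc) (f≥0 ∘ suc) j)
    (subst (_≤ sumFin f) (ℚP.+-identityˡ _) (ℚP.+-monoˡ-≤ (sumFin (f ∘ suc)) (f≥0 zero)))

module Reflections {n} (B : Fin n → Fin n → ℚ) (B-sym : ∀ i j → B i j ≡ B j i) where

  open import Data.Vec using (lookup)
  open import Data.Vec.Properties using (lookup-map; lookup-zipWith)
  open import Data.Vec.Relation.Binary.Pointwise.Extensional using (ext; Pointwise-≡⇒≡)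
  open FiniteSums
  open Rationals

  infix 9 _·_
  _·_ : V n → V n → ℚ
  x · y = inner B x y

  ⦅_,_⦆ : V n → V n → ℚ
  ⦅ x , a ⦆ = coPair B x a

  ‖_‖² : V n → ℚ
  ‖ v ‖² = v · v

  reflect : V n → V n → V n
  reflect a = sAff B a (ℤ.+ 0)

  vec-ext : ∀ {u v : V n} → (∀ t → lookup u t ≡ lookup v t) → u ≡ v
  vec-ext u≗v = Pointwise-≡⇒≡ (ext u≗v)

  lookup-neg : ∀ (v : V n) t → lookup (-ᵥ v) t ≡ - lookup v t
  lookup-neg v t = lookup-map t -_ v

  lookup-sAff : ∀ a k x t → lookup (sAff B a k x) t ≡ lookup x t - (⦅ x , a ⦆ - ℤtoℚ k) * lookup a t
  lookup-sAff a k x t =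
    trans (lookup-zipWith _-_ t x _) (cong (_-_ (lookup x t)) (lookup-map t _ a))

  lookup-reflect : ∀ a x t → lookup (reflect a x) t ≡ lookup x t - ⦅ x , a ⦆ * lookup a t
  lookup-reflect a x t = trans (lookup-sAff a (ℤ.+ 0) x t)
    (cong (λ c → lookup x t - c * lookup a t) (ℚP.+-identityʳ ⦅ x , a ⦆))

  inner-linearʳ : ∀ x z a y b u → (∀ t → lookup z t ≡ a * lookup y t + b * lookup u t) →
                  x · z ≡ a * (x · y) + b * (x · u)
  inner-linearʳ x z a y b u z≗ay+bu = begin
    sumFin (λ i → sumFin (λ j → X i j z))
      ≡⟨ sumFin-cong (λ i → sumFin-cong (λ j → expand i j)) ⟩
    sumFin (λ i → sumFin (λ j → a * X i j y + b * X i j u))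
      ≡⟨ sumFin-cong (λ i → sumFin-+ (λ j → a * X i j y) (λ j → b * X i j u)) ⟩
    sumFin (λ i → sumFin (λ j → a * X i j y) + sumFin (λ j → b * X i j u))
      ≡⟨ sumFin-+ (λ i → sumFin (λ j → a * X i j y)) (λ i → sumFin (λ j → b * X i j u)) ⟩
    sumFin (λ i → sumFin (λ j → a * X i j y)) + sumFin (λ i → sumFin (λ j → b * X i j u))
      ≡⟨ cong₂ _+_ (pull a y) (pull b u) ⟩
    a * (x · y) + b * (x · u) ∎
    where
    X : Fin n → Fin n → V n → ℚ
    X i j v = lookup x i * (B i j * lookup v j)
    expand : ∀ i j → X i j z ≡ a * X i j y + b * X i j u
    expand i j = trans (cong (λ q → lookup x i * (B i j * q)) (z≗ay+bu j))
      (solve 6 (λ xi Bij a yj b uj → xi :* (Bij :* (a :* yj :+ b :* uj))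
                                 := a :* (xi :* (Bij :* yj)) :+ b :* (xi :* (Bij :* uj)))
             refl (lookup x i) (B i j) a (lookup y j) b (lookup u j))
    pull : ∀ c v → sumFin (λ i → sumFin (λ j → c * X i j v)) ≡ c * (x · v)
    pull c v = begin
      sumFin (λ i → sumFin (λ j → c * X i j v))
        ≡⟨ sumFin-cong (λ i → *-distribˡ-sumFin c (λ j → X i j v)) ⟨
      sumFin (λ i → c * sumFin (λ j → X i j v))
        ≡⟨ *-distribˡ-sumFin c (λ i → sumFin (λ j → X i j v)) ⟨
      c * (x · v) ∎

  inner-comm : ∀ x y → x · y ≡ y · x
  inner-comm x y = trans (sumFin-comm (λ i j → lookup x i * (B i j * lookup y j)))
    (sumFin-cong (λ i → sumFin-cong (λ j →
      trans (cong (λ b → lookup x j * (b * lookup y i)) (B-sym j i))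
            (solve 3 (λ xj b yi → xj :* (b :* yi) := yi :* (b :* xj))
                   refl (lookup x j) (B i j) (lookup y i)))))

  inner-scaleʳ : ∀ x c v → x · (c ·ᵥ v) ≡ c * (x · v)
  inner-scaleʳ x c v = trans
    (inner-linearʳ x (c ·ᵥ v) c v 0ℚ v (λ t → trans (lookup-map t (c *_) v)
      (solve 2 (λ c v → c :* v := c :* v :+ con 0ℚ :* v) refl c (lookup v t))))
    (solve 2 (λ c p → c :* p :+ con 0ℚ :* p := c :* p) refl c (x · v))

  inner-negʳ : ∀ x v → x · (-ᵥ v) ≡ - (x · v)
  inner-negʳ x v = trans
    (inner-linearʳ x (-ᵥ v) (- 1ℚ) v 0ℚ v (λ t → trans (lookup-neg v t)
      (solve 1 (λ v → :- v := :- con 1ℚ :* v :+ con 0ℚ :* v) refl (lookup v t))))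
    (solve 1 (λ p → :- con 1ℚ :* p :+ con 0ℚ :* p := :- p) refl (x · v))

  inner-sAffʳ : ∀ u a k x → u · sAff B a k x ≡ u · x - (⦅ x , a ⦆ - ℤtoℚ k) * (u · a)
  inner-sAffʳ u a k x = trans
    (inner-linearʳ u (sAff B a k x) 1ℚ x (- c) a (λ t → trans (lookup-sAff a k x t)
      (solve 3 (λ x c a → x :- c :* a := con 1ℚ :* x :+ (:- c) :* a) refl (lookup x t) c (lookup a t))))
    (solve 3 (λ p c q → con 1ℚ :* p :+ (:- c) :* q := p :- c :* q) refl (u · x) c (u · a))
    where c = ⦅ x , a ⦆ - ℤtoℚ k

  inner-reflectʳ : ∀ u a x → u · reflect a x ≡ u · x - ⦅ x , a ⦆ * (u · a)
  inner-reflectʳ u a x = trans (inner-sAffʳ u a (ℤ.+ 0) x)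
    (cong (λ c → u · x - c * (u · a)) (ℚP.+-identityʳ ⦅ x , a ⦆))

  inner-sAff-reflectʳ : ∀ u a k x → u · sAff B a k x ≡ u · reflect a x + ℤtoℚ k * (u · a)
  inner-sAff-reflectʳ u a k x = begin
    u · sAff B a k x
      ≡⟨ inner-sAffʳ u a k x ⟩
    u · x - (⦅ x , a ⦆ - ℤtoℚ k) * (u · a)
      ≡⟨ solve 4 (λ p c k q → p :- (c :- k) :* q := p :- c :* q :+ k :* q)
           refl (u · x) ⦅ x , a ⦆ (ℤtoℚ k) (u · a) ⟩
    u · x - ⦅ x , a ⦆ * (u · a) + ℤtoℚ k * (u · a)
      ≡⟨ cong (_+ ℤtoℚ k * (u · a)) (inner-reflectʳ u a x) ⟨
    u · reflect a x + ℤtoℚ k * (u · a) ∎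

  coPair-*-norm² : ∀ x a → ‖ a ‖² ≢ 0ℚ → ⦅ x , a ⦆ * ‖ a ‖² ≡ 2ℚ * (a · x)
  coPair-*-norm² x a = ÷₀-*-cancel (2ℚ * (a · x))

  coPair-unique : ∀ x a c → ‖ a ‖² ≢ 0ℚ → c * ‖ a ‖² ≡ 2ℚ * (a · x) → ⦅ x , a ⦆ ≡ c
  coPair-unique x a c ‖a‖²≢0 c‖a‖²≡2a·x =
    *-cancelʳ-≡ ‖ a ‖² ‖a‖²≢0 (trans (coPair-*-norm² x a ‖a‖²≢0) (sym c‖a‖²≡2a·x))

  coPair-*-inner : ∀ x y a → ‖ a ‖² ≢ 0ℚ → ⦅ x , a ⦆ * (a · y) ≡ ⦅ y , a ⦆ * (a · x)
  coPair-*-inner x y a ‖a‖²≢0 = *-cancelʳ-≡ ‖ a ‖² ‖a‖²≢0 (begin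
    ⦅ x , a ⦆ * (a · y) * ‖ a ‖²   ≡⟨ swap ⦅ x , a ⦆ (a · y) ‖ a ‖² ⟩
    ⦅ x , a ⦆ * ‖ a ‖² * (a · y)   ≡⟨ cong (_* (a · y)) (coPair-*-norm² x a ‖a‖²≢0) ⟩
    2ℚ * (a · x) * (a · y)        ≡⟨ swap 2ℚ (a · x) (a · y) ⟩
    2ℚ * (a · y) * (a · x)        ≡⟨ cong (_* (a · x)) (coPair-*-norm² y a ‖a‖²≢0) ⟨
    ⦅ y , a ⦆ * ‖ a ‖² * (a · x)   ≡⟨ swap ⦅ y , a ⦆ ‖ a ‖² (a · x) ⟩
    ⦅ y , a ⦆ * (a · x) * ‖ a ‖²   ∎)
    where
    swap : ∀ p q r → p * q * r ≡ p * r * q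
    swap = solve 3 (λ p q r → p :* q :* r := p :* r :* q) refl

  reflect-selfAdjoint : ∀ a u v → ‖ a ‖² ≢ 0ℚ → reflect a u · v ≡ u · reflect a v
  reflect-selfAdjoint a u v ‖a‖²≢0 = begin
    reflect a u · v
      ≡⟨ inner-comm (reflect a u) v ⟩
    v · reflect a u
      ≡⟨ inner-reflectʳ v a u ⟩
    v · u - ⦅ u , a ⦆ * (v · a)
      ≡⟨ cong₂ (λ p q → p - ⦅ u , a ⦆ * q) (inner-comm v u) (inner-comm v a) ⟩
    u · v - ⦅ u , a ⦆ * (a · v)
      ≡⟨ cong (_-_ (u · v)) (coPair-*-inner u v a ‖a‖²≢0) ⟩
    u · v - ⦅ v , a ⦆ * (a · u)
      ≡⟨ cong (λ q → u · v - ⦅ v , a ⦆ * q) (inner-comm a u) ⟩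
    u · v - ⦅ v , a ⦆ * (u · a)
      ≡⟨ inner-reflectʳ u a v ⟨
    u · reflect a v ∎

  coPair-negˡ : ∀ x a → ‖ a ‖² ≢ 0ℚ → ⦅ -ᵥ x , a ⦆ ≡ - ⦅ x , a ⦆
  coPair-negˡ x a ‖a‖²≢0 = coPair-unique (-ᵥ x) a _ ‖a‖²≢0 (begin
    - ⦅ x , a ⦆ * ‖ a ‖²    ≡⟨ ℚP.neg-distribˡ-* ⦅ x , a ⦆ ‖ a ‖² ⟨
    - (⦅ x , a ⦆ * ‖ a ‖²)  ≡⟨ cong -_ (coPair-*-norm² x a ‖a‖²≢0) ⟩
    - (2ℚ * (a · x))       ≡⟨ ℚP.neg-distribʳ-* 2ℚ (a · x) ⟩
    2ℚ * - (a · x)         ≡⟨ cong (2ℚ *_) (inner-negʳ a x) ⟨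
    2ℚ * (a · (-ᵥ x))      ∎)

  coPair-reflectˡ : ∀ x a → ‖ a ‖² ≢ 0ℚ → ⦅ reflect a x , a ⦆ ≡ - ⦅ x , a ⦆
  coPair-reflectˡ x a ‖a‖²≢0 = coPair-unique (reflect a x) a _ ‖a‖²≢0 (begin
    - ⦅ x , a ⦆ * ‖ a ‖²
      ≡⟨ ℚP.neg-distribˡ-* ⦅ x , a ⦆ ‖ a ‖² ⟨
    - (⦅ x , a ⦆ * ‖ a ‖²)
      ≡⟨ cong -_ (coPair-*-norm² x a ‖a‖²≢0) ⟩
    - (2ℚ * (a · x))
      ≡⟨ solve 1 (λ p → :- (con 2ℚ :* p) := con 2ℚ :* (p :- con 2ℚ :* p)) refl (a · x) ⟩
    2ℚ * ((a · x) - 2ℚ * (a · x))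
      ≡⟨ cong (λ q → 2ℚ * ((a · x) - q)) (coPair-*-norm² x a ‖a‖²≢0) ⟨
    2ℚ * ((a · x) - ⦅ x , a ⦆ * ‖ a ‖²)
      ≡⟨ cong (2ℚ *_) (inner-reflectʳ a a x) ⟨
    2ℚ * (a · reflect a x) ∎)

  reflect-involutive : ∀ a v → ‖ a ‖² ≢ 0ℚ → reflect a (reflect a v) ≡ v
  reflect-involutive a v ‖a‖²≢0 = vec-ext λ t → begin
    lookup (reflect a (reflect a v)) t
      ≡⟨ lookup-reflect a (reflect a v) t ⟩
    lookup (reflect a v) t - ⦅ reflect a v , a ⦆ * lookup a t
      ≡⟨ cong₂ (λ p c → p - c * lookup a t) (lookup-reflect a v t) (coPair-reflectˡ v a ‖a‖²≢0) ⟩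
    (lookup v t - ⦅ v , a ⦆ * lookup a t) - (- ⦅ v , a ⦆) * lookup a t
      ≡⟨ solve 3 (λ v c a → (v :- c :* a) :- (:- c) :* a := v)
           refl (lookup v t) ⦅ v , a ⦆ (lookup a t) ⟩
    lookup v t ∎

  reflect-neg : ∀ a v → ‖ a ‖² ≢ 0ℚ → reflect a (-ᵥ v) ≡ -ᵥ reflect a v
  reflect-neg a v ‖a‖²≢0 = vec-ext λ t → begin
    lookup (reflect a (-ᵥ v)) t
      ≡⟨ lookup-reflect a (-ᵥ v) t ⟩
    lookup (-ᵥ v) t - ⦅ -ᵥ v , a ⦆ * lookup a t
      ≡⟨ cong₂ (λ p c → p - c * lookup a t) (lookup-neg v t) (coPair-negˡ v a ‖a‖²≢0) ⟩
    - lookup v t - (- ⦅ v , a ⦆) * lookup a t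
      ≡⟨ solve 3 (λ v c a → :- v :- (:- c) :* a := :- (v :- c :* a))
           refl (lookup v t) ⦅ v , a ⦆ (lookup a t) ⟩
    - (lookup v t - ⦅ v , a ⦆ * lookup a t)
      ≡⟨ cong -_ (lookup-reflect a v t) ⟨
    - lookup (reflect a v) t
      ≡⟨ lookup-neg (reflect a v) t ⟨
    lookup (-ᵥ reflect a v) t ∎

  neg-involutive : ∀ (v : V n) → -ᵥ (-ᵥ v) ≡ v
  neg-involutive v = vec-ext λ t → begin
    lookup (-ᵥ (-ᵥ v)) t  ≡⟨ lookup-neg (-ᵥ v) t ⟩
    - lookup (-ᵥ v) t     ≡⟨ cong -_ (lookup-neg v t) ⟩
    - - lookup v t        ≡⟨ solve 1 (λ v → :- (:- v) := v) refl (lookup v t) ⟩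
    lookup v t            ∎

  neg-injective : ∀ {u v : V n} → -ᵥ u ≡ -ᵥ v → u ≡ v
  neg-injective {u} {v} -u≡-v = begin
    u            ≡⟨ neg-involutive u ⟨
    -ᵥ (-ᵥ u)    ≡⟨ cong -ᵥ_ -u≡-v ⟩
    -ᵥ (-ᵥ v)    ≡⟨ neg-involutive v ⟩
    v            ∎

  norm²-neg : ∀ v → ‖ -ᵥ v ‖² ≡ ‖ v ‖²
  norm²-neg v = begin
    (-ᵥ v) · (-ᵥ v)   ≡⟨ inner-negʳ (-ᵥ v) v ⟩
    - ((-ᵥ v) · v)    ≡⟨ cong -_ (inner-comm (-ᵥ v) v) ⟩
    - (v · (-ᵥ v))    ≡⟨ cong -_ (inner-negʳ v v) ⟩
    - - (v · v)       ≡⟨ solve 1 (λ p → :- (:- p) := p) refl (v · v) ⟩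
    v · v             ∎

  norm²-reflect : ∀ a v → ‖ a ‖² ≢ 0ℚ → ‖ reflect a v ‖² ≡ ‖ v ‖²
  norm²-reflect a v ‖a‖²≢0 = begin
    reflect a v · reflect a v    ≡⟨ reflect-selfAdjoint a v (reflect a v) ‖a‖²≢0 ⟩
    v · reflect a (reflect a v)  ≡⟨ cong (v ·_) (reflect-involutive a v ‖a‖²≢0) ⟩
    v · v                        ∎

  coPair-negʳ : ∀ x v → ‖ v ‖² ≢ 0ℚ → ⦅ x , -ᵥ v ⦆ ≡ - ⦅ x , v ⦆
  coPair-negʳ x v ‖v‖²≢0 = coPair-unique x (-ᵥ v) _ ‖-v‖²≢0 (begin
    - ⦅ x , v ⦆ * ‖ -ᵥ v ‖²    ≡⟨ cong (- ⦅ x , v ⦆ *_) (norm²-neg v) ⟩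
    - ⦅ x , v ⦆ * ‖ v ‖²       ≡⟨ ℚP.neg-distribˡ-* ⦅ x , v ⦆ ‖ v ‖² ⟨
    - (⦅ x , v ⦆ * ‖ v ‖²)     ≡⟨ cong -_ (coPair-*-norm² x v ‖v‖²≢0) ⟩
    - (2ℚ * (v · x))          ≡⟨ ℚP.neg-distribʳ-* 2ℚ (v · x) ⟩
    2ℚ * - (v · x)            ≡⟨ cong (λ p → 2ℚ * - p) (inner-comm v x) ⟩
    2ℚ * - (x · v)            ≡⟨ cong (2ℚ *_) (inner-negʳ x v) ⟨
    2ℚ * (x · (-ᵥ v))         ≡⟨ cong (2ℚ *_) (inner-comm x (-ᵥ v)) ⟩
    2ℚ * ((-ᵥ v) · x)         ∎)
    where
    ‖-v‖²≢0 : ‖ -ᵥ v ‖² ≢ 0ℚ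
    ‖-v‖²≢0 = ‖v‖²≢0 ∘ trans (sym (norm²-neg v))

  coPair-reflectʳ : ∀ a c → ‖ a ‖² ≢ 0ℚ → ‖ c ‖² ≢ 0ℚ → ⦅ a , reflect a c ⦆ ≡ - ⦅ a , c ⦆
  coPair-reflectʳ a c ‖a‖²≢0 ‖c‖²≢0 = coPair-unique a σ _ ‖σ‖²≢0 (begin
    - ⦅ a , c ⦆ * ‖ σ ‖²
      ≡⟨ cong (- ⦅ a , c ⦆ *_) (norm²-reflect a c ‖a‖²≢0) ⟩
    - ⦅ a , c ⦆ * ‖ c ‖²
      ≡⟨ ℚP.neg-distribˡ-* ⦅ a , c ⦆ ‖ c ‖² ⟨
    - (⦅ a , c ⦆ * ‖ c ‖²)
      ≡⟨ cong -_ (coPair-*-norm² a c ‖c‖²≢0) ⟩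
    - (2ℚ * (c · a))
      ≡⟨ cong (λ p → - (2ℚ * p)) (inner-comm c a) ⟩
    - (2ℚ * (a · c))
      ≡⟨ solve 1 (λ p → :- (con 2ℚ :* p) := con 2ℚ :* (p :- con 2ℚ :* p)) refl (a · c) ⟩
    2ℚ * (a · c - 2ℚ * (a · c))
      ≡⟨ cong (λ p → 2ℚ * (a · c - p)) (coPair-*-norm² c a ‖a‖²≢0) ⟨
    2ℚ * (a · c - ⦅ c , a ⦆ * ‖ a ‖²)
      ≡⟨ cong (2ℚ *_) (inner-reflectʳ a a c) ⟨
    2ℚ * (a · σ)
      ≡⟨ cong (2ℚ *_) (inner-comm a σ) ⟩
    2ℚ * (σ · a) ∎)
    where
    σ = reflect a c
    ‖σ‖²≢0 : ‖ σ ‖² ≢ 0ℚ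
    ‖σ‖²≢0 = ‖c‖²≢0 ∘ trans (sym (norm²-reflect a c ‖a‖²≢0))

  coPair-sAff : ∀ a k y c → ‖ a ‖² ≢ 0ℚ → ‖ c ‖² ≢ 0ℚ →
                ⦅ sAff B a k y , c ⦆ ≡ ⦅ y , reflect a c ⦆ + ℤtoℚ k * ⦅ a , c ⦆
  coPair-sAff a k y c ‖a‖²≢0 ‖c‖²≢0 = coPair-unique (sAff B a k y) c _ ‖c‖²≢0 (begin
    (⦅ y , σ ⦆ + K * ⦅ a , c ⦆) * ‖ c ‖²
      ≡⟨ solve 4 (λ u K v N → (u :+ K :* v) :* N := u :* N :+ K :* (v :* N))
           refl ⦅ y , σ ⦆ K ⦅ a , c ⦆ ‖ c ‖² ⟩
    ⦅ y , σ ⦆ * ‖ c ‖² + K * (⦅ a , c ⦆ * ‖ c ‖²)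
      ≡⟨ cong₂ (λ N q → ⦅ y , σ ⦆ * N + K * q)
           (norm²-reflect a c ‖a‖²≢0) (sym (coPair-*-norm² a c ‖c‖²≢0)) ⟨
    ⦅ y , σ ⦆ * ‖ σ ‖² + K * (2ℚ * (c · a))
      ≡⟨ cong (_+ K * (2ℚ * (c · a))) (coPair-*-norm² y σ ‖σ‖²≢0) ⟩
    2ℚ * (σ · y) + K * (2ℚ * (c · a))
      ≡⟨ cong (λ p → 2ℚ * p + K * (2ℚ * (c · a))) (reflect-selfAdjoint a c y ‖a‖²≢0) ⟩
    2ℚ * (c · reflect a y) + K * (2ℚ * (c · a))
      ≡⟨ solve 3 (λ p K q → con 2ℚ :* p :+ K :* (con 2ℚ :* q) := con 2ℚ :* (p :+ K :* q))
           refl (c · reflect a y) K (c · a) ⟩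
    2ℚ * (c · reflect a y + K * (c · a))
      ≡⟨ cong (2ℚ *_) (inner-sAff-reflectʳ c a k y) ⟨
    2ℚ * (c · sAff B a k y) ∎)
    where
    σ = reflect a c
    K = ℤtoℚ k
    ‖σ‖²≢0 : ‖ σ ‖² ≢ 0ℚ
    ‖σ‖²≢0 = ‖c‖²≢0 ∘ trans (sym (norm²-reflect a c ‖a‖²≢0))

  coPair-scaleˡ : ∀ c x a → ‖ a ‖² ≢ 0ℚ → ⦅ c ·ᵥ x , a ⦆ ≡ c * ⦅ x , a ⦆
  coPair-scaleˡ c x a ‖a‖²≢0 = coPair-unique (c ·ᵥ x) a _ ‖a‖²≢0 (begin
    c * ⦅ x , a ⦆ * ‖ a ‖²
      ≡⟨ ℚP.*-assoc c ⦅ x , a ⦆ ‖ a ‖² ⟩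
    c * (⦅ x , a ⦆ * ‖ a ‖²)
      ≡⟨ cong (c *_) (coPair-*-norm² x a ‖a‖²≢0) ⟩
    c * (2ℚ * (a · x))
      ≡⟨ solve 3 (λ c t p → c :* (t :* p) := t :* (c :* p)) refl c 2ℚ (a · x) ⟩
    2ℚ * (c * (a · x))
      ≡⟨ cong (2ℚ *_) (inner-scaleʳ a c x) ⟨
    2ℚ * (a · (c ·ᵥ x)) ∎)

  coPair-positive : ∀ x a → 0ℚ < ‖ a ‖² → 0ℚ < a · x → 0ℚ < ⦅ x , a ⦆
  coPair-positive x a ‖a‖²>0 a·x>0 = ℚP.*-cancelʳ-<-nonNeg ‖ a ‖² {{ℚ.nonNegative (ℚP.<⇒≤ ‖a‖²>0)}}
    (subst₂ _<_ (sym (ℚP.*-zeroˡ ‖ a ‖²)) (sym (coPair-*-norm² x a (≢-sym (ℚP.<⇒≢ ‖a‖²>0))))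
      (subst (_< 2ℚ * (a · x)) (ℚP.*-zeroʳ 2ℚ) (ℚP.*-monoʳ-<-pos 2ℚ a·x>0)))

module PositiveSystem (R : RootDatum) where

  open import Data.Bool using (true; false)
  open import Data.Bool.Properties using (if-cong)
  open import Data.Fin.Permutation using (permutation)
  open import Data.Fin.Properties using (any?)
  open import Data.Product using (∃)
  open import Data.Sum using (_⊎_; inj₁; inj₂)
  open import Relation.Nullary.Decidable using (dec-true; dec-false)
  open RootDatum R
  open Reflections B B-sym
  open FiniteSums
  open Rationals

  root-norm²-positive : ∀ {v} → v ∈Φ → 0ℚ < ‖ v ‖²
  root-norm²-positive (i , ρi≡v) = subst (λ v → 0ℚ < ‖ v ‖²) ρi≡v (B-posdef (ρ i) (nonzero i))

  β-norm²≢0 : ∀ i → ‖ β i ‖² ≢ 0ℚ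
  β-norm²≢0 i = ≢-sym (ℚP.<⇒≢ (root-norm²-positive (β-root i)))

  β≢-β : ∀ i j → β i ≢ -ᵥ β j
  β≢-β i j βi≡-βj = ℚP.<-irrefl refl
    (subst (0ℚ <_) (ℚP.+-inverseʳ (f · β j)) (ℚP.+-mono-< (f·β>0 j) 0<-f·βj))
    where
    f = proj₁ β-positive
    f·β>0 = proj₂ β-positive
    0<-f·βj : 0ℚ < - (f · β j)
    0<-f·βj = subst (0ℚ <_) (trans (cong (f ·_) βi≡-βj) (inner-negʳ f (β j))) (f·β>0 i)

  root-signedβ : ∀ {v} → v ∈Φ → ∃ λ d → (v ≡ β d) ⊎ (v ≡ -ᵥ β d)
  root-signedβ (k , ρk≡v) with β-cover k
  ... | inj₁ (d , ρk≡βd) = d , inj₁ (trans (sym ρk≡v) ρk≡βd)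
  ... | inj₂ (d , ρk≡-βd) = d , inj₂ (trans (sym ρk≡v) ρk≡-βd)

  reflect-β∈Φ : ∀ a g → reflect (β a) (β g) ∈Φ
  reflect-β∈Φ a g with β-root a | β-root g
  ... | i , ρi≡βa | j , ρj≡βg with refl-closed i j
  ... | k , ρk≡sρiρj = k , trans ρk≡sρiρj (cong₂ reflect ρi≡βa ρj≡βg)

  reflect-signedβ : ∀ a g → ∃ λ d → (reflect (β a) (β g) ≡ β d) ⊎ (reflect (β a) (β g) ≡ -ᵥ β d)
  reflect-signedβ a g = root-signedβ (reflect-β∈Φ a g)

  reflect-β-swap : ∀ a {u v} → reflect (β a) u ≡ v → reflect (β a) v ≡ u
  reflect-β-swap a {u} su≡v =
    trans (cong (reflect (β a)) (sym su≡v)) (reflect-involutive (β a) u (β-norm²≢0 a))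

  reflect-β-swap-neg : ∀ a {u v} → reflect (β a) u ≡ -ᵥ v → reflect (β a) v ≡ -ᵥ u
  reflect-β-swap-neg a {u} {v} su≡-v = begin
    reflect (β a) v              ≡⟨ neg-involutive (reflect (β a) v) ⟨
    -ᵥ (-ᵥ reflect (β a) v)      ≡⟨ cong -ᵥ_ (reflect-neg (β a) v (β-norm²≢0 a)) ⟨
    -ᵥ reflect (β a) (-ᵥ v)      ≡⟨ cong -ᵥ_ (reflect-β-swap a su≡-v) ⟩
    -ᵥ u                         ∎

  ℓ≡1 : ∀ a g i → reflect (β a) (β i) ≡ β g → ℓ R a g i ≡ 1ℚ
  ℓ≡1 a g i sβi≡βg = if-cong (dec-true (reflect (β a) (β i) ≟ᵥ β g) sβi≡βg)

  ℓ≡-1 : ∀ a g i → reflect (β a) (β i) ≡ -ᵥ β g → ℓ R a g i ≡ - 1ℚ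
  ℓ≡-1 a g i sβi≡-βg = trans
    (if-cong (dec-false (reflect (β a) (β i) ≟ᵥ β g) (λ sβi≡βg → β≢-β g g (trans (sym sβi≡βg) sβi≡-βg))))
    (if-cong (dec-true (reflect (β a) (β i) ≟ᵥ (-ᵥ β g)) sβi≡-βg))

  ℓ≡0 : ∀ a g i → reflect (β a) (β i) ≢ β g → reflect (β a) (β i) ≢ -ᵥ β g → ℓ R a g i ≡ 0ℚ
  ℓ≡0 a g i sβi≢βg sβi≢-βg = trans
    (if-cong (dec-false (reflect (β a) (β i) ≟ᵥ β g) sβi≢βg))
    (if-cong (dec-false (reflect (β a) (β i) ≟ᵥ (-ᵥ β g)) sβi≢-βg))

  L-single : ∀ a g d (x : Pt R) c → ℓ R a g d ≡ c → (∀ i → i ≢ d → ℓ R a g i ≡ 0ℚ) → L R a x g ≡ c * x d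
  L-single a g d x c ℓ≡c ℓ≡0-elsewhere = trans
    (sumFin-single (λ i → ℓ R a g i * x i) d
      (λ i i≢d → trans (cong (_* x i) (ℓ≡0-elsewhere i i≢d)) (ℚP.*-zeroˡ (x i))))
    (cong (_* x d) ℓ≡c)

  L-pos : ∀ a g d (x : Pt R) → reflect (β a) (β g) ≡ β d → L R a x g ≡ x d
  L-pos a g d x sβg≡βd = trans
    (L-single a g d x 1ℚ (ℓ≡1 a g d (reflect-β-swap a sβg≡βd)) ℓ≡0-elsewhere)
    (ℚP.*-identityˡ (x d))
    where
    ℓ≡0-elsewhere : ∀ i → i ≢ d → ℓ R a g i ≡ 0ℚ
    ℓ≡0-elsewhere i i≢d = ℓ≡0 a g i
      (λ sβi≡βg → i≢d (β-inj i d (trans (sym (reflect-β-swap a sβi≡βg)) sβg≡βd)))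
      (λ sβi≡-βg → β≢-β d i (trans (sym sβg≡βd) (reflect-β-swap-neg a sβi≡-βg)))

  L-neg : ∀ a g d (x : Pt R) → reflect (β a) (β g) ≡ -ᵥ β d → L R a x g ≡ - x d
  L-neg a g d x sβg≡-βd = trans
    (L-single a g d x (- 1ℚ) (ℓ≡-1 a g d (reflect-β-swap-neg a sβg≡-βd)) ℓ≡0-elsewhere)
    (solve 1 (λ x → :- con 1ℚ :* x := :- x) refl (x d))
    where
    ℓ≡0-elsewhere : ∀ i → i ≢ d → ℓ R a g i ≡ 0ℚ
    ℓ≡0-elsewhere i i≢d = ℓ≡0 a g i
      (λ sβi≡βg → β≢-β i d (trans (sym (reflect-β-swap a sβi≡βg)) sβg≡-βd))
      (λ sβi≡-βg → i≢d (β-inj i d (neg-injective (trans (sym (reflect-β-swap-neg a sβi≡-βg)) sβg≡-βd))))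

  L-involutive : ∀ a (x : Pt R) g → L R a (L R a x) g ≡ x g
  L-involutive a x g with reflect-signedβ a g
  ... | d , inj₁ sβg≡βd = trans (L-pos a g d (L R a x) sβg≡βd) (L-pos a d g x (reflect-β-swap a sβg≡βd))
  ... | d , inj₂ sβg≡-βd = begin
    L R a (L R a x) g  ≡⟨ L-neg a g d (L R a x) sβg≡-βd ⟩
    - L R a x d        ≡⟨ cong -_ (L-neg a d g x (reflect-β-swap-neg a sβg≡-βd)) ⟩
    - - x g            ≡⟨ solve 1 (λ x → :- (:- x) := x) refl (x g) ⟩
    x g                ∎

  reflectIndex : Fin m → Fin m → Fin m
  reflectIndex a g = proj₁ (reflect-signedβ a g)

  reflectIndex-involutive : ∀ a g → reflectIndex a (reflectIndex a g) ≡ g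
  reflectIndex-involutive a g with reflect-signedβ a g
  ... | d , sβg≡±βd with reflect-signedβ a d | sβg≡±βd
  ... | e , inj₁ sβd≡βe  | inj₁ sβg≡βd  = β-inj e g (trans (sym sβd≡βe) (reflect-β-swap a sβg≡βd))
  ... | e , inj₂ sβd≡-βe | inj₁ sβg≡βd  =
    ⊥-elim (β≢-β g e (trans (sym (reflect-β-swap a sβg≡βd)) sβd≡-βe))
  ... | e , inj₁ sβd≡βe  | inj₂ sβg≡-βd =
    ⊥-elim (β≢-β e g (trans (sym sβd≡βe) (reflect-β-swap-neg a sβg≡-βd)))
  ... | e , inj₂ sβd≡-βe | inj₂ sβg≡-βd =
    β-inj e g (neg-injective (trans (sym sβd≡-βe) (reflect-β-swap-neg a sβg≡-βd)))

  F-isometry : ∀ p a → IsIsometry R (F R p a)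
  F-isometry p a x y = begin
    sumFin (λ g → (F R p a x g - F R p a y g) * (F R p a x g - F R p a y g))
      ≡⟨ sumFin-cong squared-difference ⟩
    sumFin (δ² ∘ reflectIndex a)
      ≡⟨ sumFin-permute δ² (permutation (reflectIndex a) (reflectIndex a)
           (reflectIndex-involutive a) (reflectIndex-involutive a)) ⟨
    sumFin δ² ∎
    where
    δ² : Fin m → ℚ
    δ² k = (x k - y k) * (x k - y k)
    shifted-square : Fin m → ℚ → ℚ → ℚ
    shifted-square g X Y = (X + vec R p a g - (Y + vec R p a g)) * (X + vec R p a g - (Y + vec R p a g))
    squared-difference : ∀ g → (F R p a x g - F R p a y g) * (F R p a x g - F R p a y g)
                               ≡ δ² (reflectIndex a g)
    squared-difference g with reflect-signedβ a g
    ... | d , inj₁ sβg≡βd = trans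
      (cong₂ (shifted-square g) (L-pos a g d x sβg≡βd) (L-pos a g d y sβg≡βd))
      (solve 3 (λ X Y V → (X :+ V :- (Y :+ V)) :* (X :+ V :- (Y :+ V)) := (X :- Y) :* (X :- Y))
             refl (x d) (y d) (vec R p a g))
    ... | d , inj₂ sβg≡-βd = trans
      (cong₂ (shifted-square g) (L-neg a g d x sβg≡-βd) (L-neg a g d y sβg≡-βd))
      (solve 3 (λ X Y V → (:- X :+ V :- (:- Y :+ V)) :* (:- X :+ V :- (:- Y :+ V)) := (X :- Y) :* (X :- Y))
             refl (x d) (y d) (vec R p a g))

  fundamentalAlcove-inhabited : ∃ (InAe R)
  fundamentalAlcove-inhabited = ε ·ᵥ f , λ j →
      subst (0ℚ <_) (sym (coPair-εf j))
        (ℚP.positive⁻¹ (ε * c j) {{ℚP.pos*pos⇒pos ε (c j) {{c-positive j}}}})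
    , subst (_< 1ℚ) (sym (coPair-εf j))
        (subst₂ _<_ (ℚP.*-comm (c j) ε) (ℚP.*-inverseʳ M) (ℚP.*-monoˡ-<-pos ε (c<M j)))
    where
    f = proj₁ β-positive
    c : Fin m → ℚ
    c j = ⦅ f , β j ⦆
    c>0 : ∀ j → 0ℚ < c j
    c>0 j = coPair-positive f (β j) (root-norm²-positive (β-root j))
      (subst (0ℚ <_) (inner-comm f (β j)) (proj₂ β-positive j))
    c-positive : ∀ j → ℚ.Positive (c j)
    c-positive j = ℚ.positive (c>0 j)
    M : ℚ
    M = sumFin c + 1ℚ
    sumFin<M : sumFin c < M
    sumFin<M = subst (_< M) (ℚP.+-identityʳ (sumFin c)) (ℚP.+-monoʳ-< (sumFin c) (ℚP.positive⁻¹ 1ℚ))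
    c<M : ∀ j → c j < M
    c<M j = ℚP.≤-<-trans (≤-sumFin c (ℚP.<⇒≤ ∘ c>0) j) sumFin<M
    instance
      M-positive : ℚ.Positive M
      M-positive = ℚ.positive (ℚP.≤-<-trans (sumFin-nonNeg c (ℚP.<⇒≤ ∘ c>0)) sumFin<M)
      M-nonZero : ℚ.NonZero M
      M-nonZero = ℚP.pos⇒nonZero M
    ε : ℚ
    ε = 1/ M
    instance
      ε-positive : ℚ.Positive ε
      ε-positive = ℚP.1/pos⇒pos M
    coPair-εf : ∀ j → ⦅ ε ·ᵥ f , β j ⦆ ≡ ε * c j
    coPair-εf j = coPair-scaleˡ ε f (β j) (β-norm²≢0 j)

  coPair-β-integral : ∀ a g → ∃ λ z → ⦅ β a , β g ⦆ ≡ ℤtoℚ z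
  coPair-β-integral a g with β-root a | β-root g
  ... | i , ρi≡βa | j , ρj≡βg with integral j i
  ... | z , ⦅ρi,ρj⦆≡z = z , trans (sym (cong₂ ⦅_,_⦆ ρi≡βa ρj≡βg)) ⦅ρi,ρj⦆≡z

  isPos-β : ∀ d → isPos R (β d) ≡ true
  isPos-β d = dec-true (any? (λ j → β j ≟ᵥ β d)) (d , refl)

  isPos-negβ : ∀ d → isPos R (-ᵥ β d) ≡ false
  isPos-negβ d = dec-false (any? (λ j → β j ≟ᵥ (-ᵥ β d))) (λ (j , βj≡-βd) → β≢-β j d βj≡-βd)

  vec-pos : ∀ p a g d → reflect (β a) (β g) ≡ β d →
            vec R p a g ≡ - (ℤtoℚ p * ⦅ β a , reflect (β a) (β g) ⦆)
  vec-pos p a g d sβg≡βd = if-cong (trans (cong (isPos R) sβg≡βd) (isPos-β d))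

  vec-neg : ∀ p a g d → reflect (β a) (β g) ≡ -ᵥ β d →
            vec R p a g ≡ - 1ℚ - ℤtoℚ p * ⦅ β a , reflect (β a) (β g) ⦆
  vec-neg p a g d sβg≡-βd = if-cong (trans (cong (isPos R) sβg≡-βd) (isPos-negβ d))

  module _ (p : ℤ) (a g : Fin m) (z : ℤ) (⦅βa,βg⦆≡z : ⦅ β a , β g ⦆ ≡ ℤtoℚ z) where

    shift-integral : - (ℤtoℚ p * ⦅ β a , reflect (β a) (β g) ⦆) ≡ ℤtoℚ (p ℤ.* z)
    shift-integral = begin
      - (ℤtoℚ p * ⦅ β a , reflect (β a) (β g) ⦆)
        ≡⟨ cong (λ q → - (ℤtoℚ p * q)) (coPair-reflectʳ (β a) (β g) (β-norm²≢0 a) (β-norm²≢0 g)) ⟩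
      - (ℤtoℚ p * - ⦅ β a , β g ⦆)
        ≡⟨ solve 2 (λ P q → :- (P :* :- q) := P :* q) refl (ℤtoℚ p) ⦅ β a , β g ⦆ ⟩
      ℤtoℚ p * ⦅ β a , β g ⦆
        ≡⟨ cong (ℤtoℚ p *_) ⦅βa,βg⦆≡z ⟩
      ℤtoℚ p * ℤtoℚ z
        ≡⟨ ℤtoℚ-* p z ⟨
      ℤtoℚ (p ℤ.* z) ∎

    coPair-sAff-β : ∀ y → ⦅ sAff B (β a) p y , β g ⦆ ≡ ⦅ y , reflect (β a) (β g) ⦆ + ℤtoℚ (p ℤ.* z)
    coPair-sAff-β y = trans (coPair-sAff (β a) p y (β g) (β-norm²≢0 a) (β-norm²≢0 g))
      (cong (⦅ y , reflect (β a) (β g) ⦆ +_) (trans (cong (ℤtoℚ p *_) ⦅βa,βg⦆≡z) (sym (ℤtoℚ-* p z))))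

    F-ι-pos : ∀ d κ κ' y → reflect (β a) (β g) ≡ β d →
              InUnitInterval (κ d) ⦅ y , β d ⦆ → InUnitInterval (κ' g) ⦅ sAff B (β a) p y , β g ⦆ →
              F R p a (ιℚ R κ) g ≡ ιℚ R κ' g
    F-ι-pos d κ κ' y sβg≡βd y∈ y′∈ = begin
      L R a (ιℚ R κ) g + vec R p a g
        ≡⟨ cong₂ _+_ (L-pos a g d (ιℚ R κ) sβg≡βd) (vec-pos p a g d sβg≡βd) ⟩
      ℤtoℚ (κ d) + - (ℤtoℚ p * ⦅ β a , reflect (β a) (β g) ⦆)
        ≡⟨ cong (ℤtoℚ (κ d) +_) shift-integral ⟩
      ℤtoℚ (κ d) + ℤtoℚ (p ℤ.* z)
        ≡⟨ ℤtoℚ-+ (κ d) (p ℤ.* z) ⟨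
      ℤtoℚ (κ d ℤ.+ p ℤ.* z)
        ≡⟨ cong ℤtoℚ (InUnitInterval-unique (κ d ℤ.+ p ℤ.* z) (κ' g) shifted y′∈) ⟩
      ℤtoℚ (κ' g) ∎
      where
      shifted : InUnitInterval (κ d ℤ.+ p ℤ.* z) ⦅ sAff B (β a) p y , β g ⦆
      shifted = subst (InUnitInterval (κ d ℤ.+ p ℤ.* z))
        (sym (trans (coPair-sAff-β y) (cong (λ v → ⦅ y , v ⦆ + ℤtoℚ (p ℤ.* z)) sβg≡βd)))
        (InUnitInterval-+ (κ d) (p ℤ.* z) y∈)

    F-ι-neg : ∀ d κ κ' y → reflect (β a) (β g) ≡ -ᵥ β d →
              InUnitInterval (κ d) ⦅ y , β d ⦆ → InUnitInterval (κ' g) ⦅ sAff B (β a) p y , β g ⦆ →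
              F R p a (ιℚ R κ) g ≡ ιℚ R κ' g
    F-ι-neg d κ κ' y sβg≡-βd y∈ y′∈ = begin
      L R a (ιℚ R κ) g + vec R p a g
        ≡⟨ cong₂ _+_ (L-neg a g d (ιℚ R κ) sβg≡-βd) (vec-neg p a g d sβg≡-βd) ⟩
      - ℤtoℚ (κ d) + (- 1ℚ - ℤtoℚ p * ⦅ β a , reflect (β a) (β g) ⦆)
        ≡⟨ cong (λ q → - ℤtoℚ (κ d) + (- 1ℚ + q)) shift-integral ⟩
      - ℤtoℚ (κ d) + (- 1ℚ + ℤtoℚ (p ℤ.* z))
        ≡⟨ ℚP.+-assoc (- ℤtoℚ (κ d)) (- 1ℚ) (ℤtoℚ (p ℤ.* z)) ⟨
      - ℤtoℚ (κ d) + - 1ℚ + ℤtoℚ (p ℤ.* z)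
        ≡⟨ cong (_+ ℤtoℚ (p ℤ.* z)) (ℤtoℚ-neg-+-1 (κ d)) ⟨
      ℤtoℚ k + ℤtoℚ (p ℤ.* z)
        ≡⟨ ℤtoℚ-+ k (p ℤ.* z) ⟨
      ℤtoℚ (k ℤ.+ p ℤ.* z)
        ≡⟨ cong ℤtoℚ (InUnitInterval-unique (k ℤ.+ p ℤ.* z) (κ' g) shifted y′∈) ⟩
      ℤtoℚ (κ' g) ∎
      where
      k = ℤ.- κ d ℤ.+ ℤ.-1ℤ
      shifted : InUnitInterval (k ℤ.+ p ℤ.* z) ⦅ sAff B (β a) p y , β g ⦆
      shifted = subst (InUnitInterval (k ℤ.+ p ℤ.* z))
        (sym (trans (coPair-sAff-β y) (cong (_+ ℤtoℚ (p ℤ.* z))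
          (trans (cong ⦅ y ,_⦆ sβg≡-βd) (coPair-negʳ y (β d) (β-norm²≢0 d))))))
        (InUnitInterval-+ k (p ℤ.* z) (InUnitInterval-neg (κ d) y∈))

  F-ι-sAff : ∀ p a κ κ' y → (∀ j → InUnitInterval (κ j) ⦅ y , β j ⦆) →
             (∀ j → InUnitInterval (κ' j) ⦅ sAff B (β a) p y , β j ⦆) →
             ∀ g → F R p a (ιℚ R κ) g ≡ ιℚ R κ' g
  F-ι-sAff p a κ κ' y y∈ y′∈ g = by-sign (reflect-signedβ a g)
    where
    z = proj₁ (coPair-β-integral a g)
    ⦅βa,βg⦆≡z = proj₂ (coPair-β-integral a g)
    by-sign : (∃ λ d → (reflect (β a) (β g) ≡ β d) ⊎ (reflect (β a) (β g) ≡ -ᵥ β d)) →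
              F R p a (ιℚ R κ) g ≡ ιℚ R κ' g
    by-sign (d , inj₁ sβg≡βd) = F-ι-pos p a g z ⦅βa,βg⦆≡z d κ κ' y sβg≡βd (y∈ d) (y′∈ g)
    by-sign (d , inj₂ sβg≡-βd) = F-ι-neg p a g z ⦅βa,βg⦆≡z d κ κ' y sβg≡-βd (y∈ d) (y′∈ g)

  F-ι : ∀ p a w κ κ' → IsAlcoveCoords R w κ → IsAlcoveCoords R ((β a , p) ∷ w) κ' →
        ∀ g → F R p a (ιℚ R κ) g ≡ ιℚ R κ' g
  F-ι p a w κ κ' w↦κ sw↦κ' = F-ι-sAff p a κ κ' y
    (proj₁ (w↦κ y) (x , x∈Ae , refl)) (proj₁ (sw↦κ' (sAff B (β a) p y)) (x , x∈Ae , refl))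
    where
    x = proj₁ fundamentalAlcove-inhabited
    x∈Ae = proj₂ fundamentalAlcove-inhabited
    y = act R w x

open RootDatum

-- Parts 2 and 3 hold for every word.
proposition3p8 : (R : RootDatum) (α θ : Fin (m R)) (p : ℤ) →
    -- 1) L_α² = id  and  F(s_{α,p}) is an isometry of ℝ^m
    ((∀ (x : Pt R) j → L R α (L R α x) j ≡ x j) × IsIsometry R (F R p α))
    -- 2) θ-coordinate of L_α(ι(w)) is k(w, s_α(θ))   (k(w,-β) = -k(w,β))
    × (∀ (w : Word R) → IsWaWord R w → ∀ κ → IsAlcoveCoords R w κ → ∀ j →
         (s₀ R (β R α) (β R θ) ≡ β R j → L R α (ιℚ R κ) θ ≡ ιℚ R κ j)
         × (s₀ R (β R α) (β R θ) ≡ -ᵥ β R j → L R α (ιℚ R κ) θ ≡ - ιℚ R κ j))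
    -- 3) F(s_{α,p})(ι(w)) = ι(s_{α,p} w)
    × (∀ (w : Word R) → IsWaWord R w → ∀ κ κ' → IsAlcoveCoords R w κ →
         IsAlcoveCoords R ((β R α , p) ∷ w) κ' → ∀ j → F R p α (ιℚ R κ) j ≡ ιℚ R κ' j)
proposition3p8 R α θ p =
    (L-involutive α , F-isometry p α)
  , (λ w _ κ _ j → L-pos α θ j (ιℚ R κ) , L-neg α θ j (ιℚ R κ))
  , (λ w _ κ κ' → F-ι p α w κ κ')
  where open PositiveSystem R
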